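{- For natural numbers $k_1,\ldots,k_N$, let $q_N(k_1,\ldots,k_N)$ denote the denominator (in lowest terms, positive) of the convergent $[0;k_1,\ldots,k_N]$, i.e. $q_{ -2}=1,q_{ -1}=0,q_0=1$, $q_j=k_jq_{j-1}+q_{j-2}$. Then for every $N\geq1$, $$\sum_{k_1=1}^{\infty}\sum_{k_2=1}^{\infty}\cdots\sum_{k_N=1}^{\infty}\frac{1}{q_N(k_1,\ldots,k_N)^2}<2.$$ -}

module Defs where

open import Data.Nat using (ℕ; zero; suc; _+_; _*_)
open import Data.List using (List; []; _∷_; map; concatMap; upTo)
open import Data.Integer using (+_)
open import Data.Rational using (ℚ; _/_; 0ℚ) renaming (_+_ to _+ℚ_)

-- Continuant recursion: with (a , b) = (q_{j-1} , q_{j-2}), next q_j = k_j * a + b.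
qGo : ℕ → ℕ → List ℕ → ℕ
qGo a b []       = a
qGo a b (k ∷ ks) = qGo (k * a + b) a ks

qDen : List ℕ → ℕ
qDen ks = qGo 1 0 ks

-- 1/n as a rational (n = 0 ↦ 0; never used, since q_N ≥ 1 for positive k_i).
inv : ℕ → ℚ
inv zero    = 0ℚ
inv (suc n) = + 1 / suc n

box : ℕ → ℕ → List (List ℕ)
box zero    M = [] ∷ []
box (suc N) M = concatMap (λ k → map (k ∷_) (box N M)) (map suc (upTo M))

sumℚ : List ℚ → ℚ
sumℚ []       = 0ℚ
sumℚ (x ∷ xs) = x +ℚ sumℚ xs

partialSum : ℕ → ℕ → ℚ
partialSum N M = sumℚ (map (λ ks → inv (qDen ks * qDen ks)) (box N M))

{-# OPTIONS --safe #-}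
-- Write S_N(a, b) for the sum of 1/q² over (k_1, …, k_N) ∈ [1, M]^N, the continuants being started
-- from (q₀, q₋₁) = (a, b).  Splitting off the first digit, q ↦ k a + b, gives
-- S_{N+1}(a, b) = Σ_{j<M} S_N(x + j a, a) with x = a + b: the first arguments run through an
-- arithmetic progression.  We show S_N(a, b) ≤ (7/4) / (a (a + b)) for N ≥ 1 and a ≥ 1.  In the
-- inductive step the bound becomes the sum of (7/4) / (y (y + a)) over the progression, which
-- telescopes to at most (7/4) / (a x) since 1/(y (y + a)) = (1/a)(1/y − 1/(y + a)).  For N = 1 we
-- keep the first two squares and compare the remaining ones with the telescoping terms, giving
-- 1/x² + 1/(x + a)² + 1/(a (x + a)), which is at most 7/(4 a x) whenever a ≤ x, with equality at
-- x = a.  Taking (a, b) = (1, 0) gives the bound 7/4 < 2.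
module Submission where

open import Defs
open import Data.Nat using (ℕ; zero; suc; _+_; _*_; _≤_; z≤n; NonZero)
open import Data.Product using (∃-syntax; _×_; _,_)
open import Data.Integer using (+_)
open import Data.Rational using (ℚ; _/_; 0ℚ; toℚᵘ; *<*)
  renaming (_<_ to _<ℚ_; _≤_ to _≤ℚ_; _+_ to _+ℚ_; _*_ to _*ℚ_)
open import Data.Nat.Properties using (m*n≢0)
import Data.Nat.Properties as ℕ
open import Data.Nat.Tactic.RingSolver using (solve-∀)
import Data.Integer as ℤ
import Data.Integer.Properties as ℤ
import Data.Rational.Properties as ℚ
open import Data.Rational.Unnormalised using (mkℚᵘ; *≤*)
  renaming (_/_ to _/ᵘ_; _≃_ to _≃ᵘ_; _+_ to _+ᵘ_; _*_ to _*ᵘ_)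
import Data.Rational.Unnormalised.Properties as ℚᵘ
open import Data.List using (List; []; _∷_; _++_; map; concatMap; applyUpTo; upTo)
open import Data.List.Properties using (map-++; map-∘; map-upTo)
open import Relation.Binary.PropositionalEquality

toℚᵘ-/ : ∀ p m .{{_ : NonZero m}} → toℚᵘ (+ p / m) ≃ᵘ + p /ᵘ m
toℚᵘ-/ p (suc q) = ℚ.toℚᵘ-fromℚᵘ (mkℚᵘ (+ p) q)

frac-≤-cross : ∀ p r m n .{{_ : NonZero m}} .{{_ : NonZero n}} →
               p * n ≤ r * m → + p / m ≤ℚ + r / n
frac-≤-cross p r m@(suc _) n@(suc _) pn≤rm = ℚ.toℚᵘ-cancel-≤ (begin
  toℚᵘ (+ p / m)  ≃⟨ toℚᵘ-/ p m ⟩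
  + p /ᵘ m        ≤⟨ *≤* (subst₂ ℤ._≤_ (ℤ.pos-* p n) (ℤ.pos-* r m) (ℤ.+≤+ pn≤rm)) ⟩
  + r /ᵘ n        ≃⟨ toℚᵘ-/ r n ⟨
  toℚᵘ (+ r / n)  ∎)
  where open ℚᵘ.≤-Reasoning

frac-≡-cross : ∀ p r m n .{{_ : NonZero m}} .{{_ : NonZero n}} →
               p * n ≡ r * m → + p / m ≡ + r / n
frac-≡-cross p r m n pn≡rm = ℚ.≤-antisym (frac-≤-cross p r m n (ℕ.≤-reflexive pn≡rm))
                                          (frac-≤-cross r p n m (ℕ.≤-reflexive (sym pn≡rm)))

frac-+ : ∀ p r m n .{{_ : NonZero m}} .{{_ : NonZero n}} →
         + p / m +ℚ + r / n ≡ (+ (p * n + r * m) / (m * n)) {{m*n≢0 m n}}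
frac-+ p r m@(suc _) n@(suc _) = ℚ.toℚᵘ-injective (begin
  toℚᵘ (+ p / m +ℚ + r / n)           ≈⟨ ℚ.toℚᵘ-homo-+ (+ p / m) (+ r / n) ⟩
  toℚᵘ (+ p / m) +ᵘ toℚᵘ (+ r / n)    ≈⟨ ℚᵘ.+-cong (toℚᵘ-/ p m) (toℚᵘ-/ r n) ⟩
  + p /ᵘ m +ᵘ + r /ᵘ n                ≡⟨ cong (_/ᵘ (m * n)) numerator ⟩
  + (p * n + r * m) /ᵘ (m * n)        ≈⟨ toℚᵘ-/ (p * n + r * m) (m * n) ⟨
  toℚᵘ (+ (p * n + r * m) / (m * n))  ∎)
  where
  open ℚᵘ.≃-Reasoning
  numerator : + p ℤ.* + n ℤ.+ + r ℤ.* + m ≡ + (p * n + r * m)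
  numerator = sym (trans (ℤ.pos-+ (p * n) (r * m)) (cong₂ ℤ._+_ (ℤ.pos-* p n) (ℤ.pos-* r m)))

frac-* : ∀ p r m n .{{_ : NonZero m}} .{{_ : NonZero n}} →
         (+ p / m) *ℚ (+ r / n) ≡ (+ (p * r) / (m * n)) {{m*n≢0 m n}}
frac-* p r m@(suc _) n@(suc _) = ℚ.toℚᵘ-injective (begin
  toℚᵘ ((+ p / m) *ℚ (+ r / n))       ≈⟨ ℚ.toℚᵘ-homo-* (+ p / m) (+ r / n) ⟩
  toℚᵘ (+ p / m) *ᵘ toℚᵘ (+ r / n)    ≈⟨ ℚᵘ.*-cong (toℚᵘ-/ p m) (toℚᵘ-/ r n) ⟩
  (+ p /ᵘ m) *ᵘ (+ r /ᵘ n)            ≡⟨ cong (_/ᵘ (m * n)) (sym (ℤ.pos-* p r)) ⟩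
  + (p * r) /ᵘ (m * n)                ≈⟨ toℚᵘ-/ (p * r) (m * n) ⟨
  toℚᵘ (+ (p * r) / (m * n))          ∎)
  where open ℚᵘ.≃-Reasoning

inv-nonNeg : ∀ n → 0ℚ ≤ℚ inv n
inv-nonNeg zero    = ℚ.≤-refl
inv-nonNeg (suc n) = frac-≤-cross 0 1 1 (suc n) z≤n

inv-antimono-≤ : ∀ {m n} .{{_ : NonZero m}} → m ≤ n → inv n ≤ℚ inv m
inv-antimono-≤ {m@(suc _)} {n@(suc _)} m≤n = frac-≤-cross 1 1 n m (ℕ.*-monoʳ-≤ 1 m≤n)

inv-partial-fractions : ∀ a x .{{_ : NonZero a}} .{{_ : NonZero x}} →
                        inv (x * (x + a)) +ℚ inv (a * (x + a)) ≡ inv (a * x)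
inv-partial-fractions a@(suc _) x@(suc _) = begin
  inv m +ℚ inv n               ≡⟨ frac-+ 1 1 m n ⟩
  + (1 * n + 1 * m) / (m * n)  ≡⟨ frac-≡-cross (1 * n + 1 * m) 1 (m * n) (a * x) (cross a x) ⟩
  inv (a * x)                  ∎
  where
  open ≡-Reasoning
  m n : ℕ
  m = x * (x + a)
  n = a * (x + a)
  cross : ∀ a x → (1 * (a * (x + a)) + 1 * (x * (x + a))) * (a * x) ≡ 1 * (x * (x + a) * (a * (x + a)))
  cross = solve-∀

seven-quarters-cross : ∀ a x → a ≤ x →
  4 * a * (x + a) * (x + a) + 4 * a * x * x + 4 * x * x * (x + a) ≤ 7 * x * (x + a) * (x + a)
seven-quarters-cross a x a≤x with d , refl ← ℕ.m≤n⇒∃[o]m+o≡n a≤x = begin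
  lhs               ≤⟨ ℕ.m≤m+n lhs slack ⟩
  lhs + slack       ≡⟨ expand a d ⟩
  7 * x * (x + a) * (x + a) ∎
  where
  open ℕ.≤-Reasoning
  lhs slack : ℕ
  lhs = 4 * a * (x + a) * (x + a) + 4 * a * x * x + 4 * x * x * (x + a)
  slack = 12 * a * a * d + 11 * a * d * d + 3 * d * d * d
  expand : ∀ a d → let x = a + d in
    4 * a * (x + a) * (x + a) + 4 * a * x * x + 4 * x * x * (x + a)
      + (12 * a * a * d + 11 * a * d * d + 3 * d * d * d)
    ≡ 7 * x * (x + a) * (x + a)
  expand = solve-∀

seven-quarters-bound : ∀ a x .{{_ : NonZero a}} → a ≤ x →
  inv (x * x) +ℚ (inv ((x + a) * (x + a)) +ℚ inv (a * (x + a))) ≤ℚ + 7 / 4 *ℚ inv (a * x)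
seven-quarters-bound (suc _) zero ()
seven-quarters-bound a@(suc _) x@(suc _) a≤x = begin
  inv l +ℚ (inv m +ℚ inv n)                      ≡⟨ cong (inv l +ℚ_) (frac-+ 1 1 m n) ⟩
  inv l +ℚ + (1 * n + 1 * m) / (m * n)           ≡⟨ frac-+ 1 (1 * n + 1 * m) l (m * n) ⟩
  + num / (l * (m * n))                          ≤⟨ frac-≤-cross num 7 (l * (m * n)) (4 * (a * x)) cross ⟩
  + 7 / (4 * (a * x))                            ≡⟨ frac-* 7 1 4 (a * x) ⟨
  + 7 / 4 *ℚ inv (a * x)                         ∎
  where
  open ℚ.≤-Reasoning
  l m n num : ℕ
  l = x * x
  m = (x + a) * (x + a)
  n = a * (x + a)
  num = 1 * (m * n) + (1 * n + 1 * m) * l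
  factorˡ : ∀ a x → let l = x * x; m = (x + a) * (x + a); n = a * (x + a) in
    (1 * (m * n) + (1 * n + 1 * m) * l) * (4 * (a * x))
    ≡ a * x * (x + a) * (4 * a * (x + a) * (x + a) + 4 * a * x * x + 4 * x * x * (x + a))
  factorˡ = solve-∀
  factorʳ : ∀ a x → let l = x * x; m = (x + a) * (x + a); n = a * (x + a) in
    a * x * (x + a) * (7 * x * (x + a) * (x + a)) ≡ 7 * (l * (m * n))
  factorʳ = solve-∀
  cross : num * (4 * (a * x)) ≤ 7 * (l * (m * n))
  cross = subst₂ _≤_ (sym (factorˡ a x)) (factorʳ a x)
            (ℕ.*-monoʳ-≤ (a * x * (x + a)) (seven-quarters-cross a x a≤x))

sumℚ-++ : ∀ xs ys → sumℚ (xs ++ ys) ≡ sumℚ xs +ℚ sumℚ ys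
sumℚ-++ []       ys = sym (ℚ.+-identityˡ (sumℚ ys))
sumℚ-++ (x ∷ xs) ys = trans (cong (x +ℚ_) (sumℚ-++ xs ys)) (sym (ℚ.+-assoc x (sumℚ xs) (sumℚ ys)))

sumℚ-map-concatMap : ∀ {A B : Set} (f : B → ℚ) (g : A → List B) xs →
                     sumℚ (map f (concatMap g xs)) ≡ sumℚ (map (λ x → sumℚ (map f (g x))) xs)
sumℚ-map-concatMap f g []       = refl
sumℚ-map-concatMap f g (x ∷ xs) = begin
  sumℚ (map f (g x ++ concatMap g xs))
    ≡⟨ cong sumℚ (map-++ f (g x) (concatMap g xs)) ⟩
  sumℚ (map f (g x) ++ map f (concatMap g xs))
    ≡⟨ sumℚ-++ (map f (g x)) (map f (concatMap g xs)) ⟩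
  sumℚ (map f (g x)) +ℚ sumℚ (map f (concatMap g xs))
    ≡⟨ cong (sumℚ (map f (g x)) +ℚ_) (sumℚ-map-concatMap f g xs) ⟩
  sumℚ (map f (g x)) +ℚ sumℚ (map (λ x → sumℚ (map f (g x))) xs) ∎
  where open ≡-Reasoning

progressionSum : (ℕ → ℚ) → (x a M : ℕ) → ℚ
progressionSum f x a zero    = 0ℚ
progressionSum f x a (suc M) = f x +ℚ progressionSum f (x + a) a M

progressionSum-shift : ∀ f x a M → progressionSum f (x + a) a M ≡ progressionSum (λ y → f (y + a)) x a M
progressionSum-shift f x a zero    = refl
progressionSum-shift f x a (suc M) = cong (f (x + a) +ℚ_) (progressionSum-shift f (x + a) a M)

progressionSum-mono-≤ : ∀ {f g} x a M .{{_ : NonZero x}} →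
                        (∀ y .{{_ : NonZero y}} → f y ≤ℚ g y) →
                        progressionSum f x a M ≤ℚ progressionSum g x a M
progressionSum-mono-≤ x a zero f≤g = ℚ.≤-refl
progressionSum-mono-≤ x@(suc _) a (suc M) f≤g = ℚ.+-mono-≤ (f≤g x) (progressionSum-mono-≤ (x + a) a M f≤g)

*-distribˡ-progressionSum : ∀ c f x a M →
                            c *ℚ progressionSum f x a M ≡ progressionSum (λ y → c *ℚ f y) x a M
*-distribˡ-progressionSum c f x a zero    = ℚ.*-zeroʳ c
*-distribˡ-progressionSum c f x a (suc M) =
  trans (ℚ.*-distribˡ-+ c (f x) _) (cong (c *ℚ f x +ℚ_) (*-distribˡ-progressionSum c f (x + a) a M))

sumℚ-applyUpTo≡progressionSum : ∀ f x a M (g : ℕ → ℚ) → (∀ j → g j ≡ f (x + j * a)) →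
                                 sumℚ (applyUpTo g M) ≡ progressionSum f x a M
sumℚ-applyUpTo≡progressionSum f x a zero    g g≡f = refl
sumℚ-applyUpTo≡progressionSum f x a (suc M) g g≡f = cong₂ _+ℚ_
  (trans (g≡f 0) (cong f (ℕ.+-identityʳ x)))
  (sumℚ-applyUpTo≡progressionSum f (x + a) a M (λ j → g (suc j))
    (λ j → trans (g≡f (suc j)) (cong f (sym (ℕ.+-assoc x a (j * a))))))

progressionSum-telescope-≤ : ∀ a x M .{{_ : NonZero a}} .{{_ : NonZero x}} →
                             progressionSum (λ y → inv (y * (y + a))) x a M ≤ℚ inv (a * x)
progressionSum-telescope-≤ a x zero = inv-nonNeg (a * x)
progressionSum-telescope-≤ a x@(suc _) (suc M) = begin
  inv (x * (x + a)) +ℚ progressionSum (λ y → inv (y * (y + a))) (x + a) a M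
    ≤⟨ ℚ.+-monoʳ-≤ (inv (x * (x + a))) (progressionSum-telescope-≤ a (x + a) M) ⟩
  inv (x * (x + a)) +ℚ inv (a * (x + a))
    ≡⟨ inv-partial-fractions a x ⟩
  inv (a * x) ∎
  where open ℚ.≤-Reasoning

progressionSum-inv²-≤₁ : ∀ a x M .{{_ : NonZero a}} .{{_ : NonZero x}} →
                         progressionSum (λ y → inv (y * y)) x a M ≤ℚ inv (x * x) +ℚ inv (a * x)
progressionSum-inv²-≤₁ a x zero = ℚ.+-mono-≤ (inv-nonNeg (x * x)) (inv-nonNeg (a * x))
progressionSum-inv²-≤₁ a x@(suc _) (suc M) = ℚ.+-monoʳ-≤ (inv (x * x)) (begin
  progressionSum (λ y → inv (y * y)) (x + a) a M
    ≡⟨ progressionSum-shift (λ y → inv (y * y)) x a M ⟩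
  progressionSum (λ y → inv ((y + a) * (y + a))) x a M
    ≤⟨ progressionSum-mono-≤ x a M square≤ ⟩
  progressionSum (λ y → inv (y * (y + a))) x a M
    ≤⟨ progressionSum-telescope-≤ a x M ⟩
  inv (a * x) ∎)
  where
  open ℚ.≤-Reasoning
  square≤ : ∀ y .{{_ : NonZero y}} → inv ((y + a) * (y + a)) ≤ℚ inv (y * (y + a))
  square≤ y@(suc _) = inv-antimono-≤ (ℕ.*-monoˡ-≤ (y + a) (ℕ.m≤m+n y a))

progressionSum-inv²-≤₂ : ∀ a x M .{{_ : NonZero a}} .{{_ : NonZero x}} →
  progressionSum (λ y → inv (y * y)) x a M ≤ℚ inv (x * x) +ℚ (inv ((x + a) * (x + a)) +ℚ inv (a * (x + a)))
progressionSum-inv²-≤₂ a x zero =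
  ℚ.+-mono-≤ (inv-nonNeg (x * x)) (ℚ.+-mono-≤ (inv-nonNeg ((x + a) * (x + a))) (inv-nonNeg (a * (x + a))))
progressionSum-inv²-≤₂ a x@(suc _) (suc M) = ℚ.+-monoʳ-≤ (inv (x * x)) (progressionSum-inv²-≤₁ a (x + a) M)

boxSum : (a b N M : ℕ) → ℚ
boxSum a b N M = sumℚ (map (λ ks → inv (qGo a b ks * qGo a b ks)) (box N M))

boxSum-suc : ∀ a b N M → boxSum a b (suc N) M ≡ progressionSum (λ y → boxSum y a N M) (a + b) a M
boxSum-suc a b N M = begin
  boxSum a b (suc N) M
    ≡⟨ sumℚ-map-concatMap term (λ k → map (k ∷_) (box N M)) (map suc (upTo M)) ⟩
  sumℚ (map (λ k → sumℚ (map term (map (k ∷_) (box N M)))) (map suc (upTo M)))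
    ≡⟨ cong sumℚ (trans (sym (map-∘ (upTo M))) (map-upTo _ M)) ⟩
  sumℚ (applyUpTo (λ j → sumℚ (map term (map (suc j ∷_) (box N M)))) M)
    ≡⟨ sumℚ-applyUpTo≡progressionSum (λ y → boxSum y a N M) (a + b) a M _ first-digit ⟩
  progressionSum (λ y → boxSum y a N M) (a + b) a M ∎
  where
  open ≡-Reasoning
  term : List ℕ → ℚ
  term ks = inv (qGo a b ks * qGo a b ks)
  first-digit : ∀ j → sumℚ (map term (map (suc j ∷_) (box N M))) ≡ boxSum (a + b + j * a) a N M
  first-digit j = trans (cong sumℚ (sym (map-∘ (box N M))))
                        (cong (λ y → boxSum y a N M) (shift a b j))
    where
    shift : ∀ a b j → suc j * a + b ≡ a + b + j * a
    shift = solve-∀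

boxSum-≤ : ∀ N a b M .{{_ : NonZero a}} → boxSum a b (suc N) M ≤ℚ + 7 / 4 *ℚ inv (a * (a + b))
boxSum-≤ zero a@(suc _) b M = begin
  boxSum a b 1 M
    ≡⟨ boxSum-suc a b 0 M ⟩
  progressionSum (λ y → boxSum y a 0 M) (a + b) a M
    ≤⟨ progressionSum-mono-≤ (a + b) a M (λ y → ℚ.≤-reflexive (ℚ.+-identityʳ (inv (y * y)))) ⟩
  progressionSum (λ y → inv (y * y)) (a + b) a M
    ≤⟨ progressionSum-inv²-≤₂ a (a + b) M ⟩
  inv ((a + b) * (a + b)) +ℚ (inv ((a + b + a) * (a + b + a)) +ℚ inv (a * (a + b + a)))
    ≤⟨ seven-quarters-bound a (a + b) (ℕ.m≤m+n a b) ⟩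
  + 7 / 4 *ℚ inv (a * (a + b)) ∎
  where open ℚ.≤-Reasoning
boxSum-≤ (suc N) a@(suc _) b M = begin
  boxSum a b (suc (suc N)) M
    ≡⟨ boxSum-suc a b (suc N) M ⟩
  progressionSum (λ y → boxSum y a (suc N) M) (a + b) a M
    ≤⟨ progressionSum-mono-≤ (a + b) a M (λ y → boxSum-≤ N y a M) ⟩
  progressionSum (λ y → + 7 / 4 *ℚ inv (y * (y + a))) (a + b) a M
    ≡⟨ *-distribˡ-progressionSum (+ 7 / 4) (λ y → inv (y * (y + a))) (a + b) a M ⟨
  + 7 / 4 *ℚ progressionSum (λ y → inv (y * (y + a))) (a + b) a M
    ≤⟨ ℚ.*-monoˡ-≤-nonNeg (+ 7 / 4) (progressionSum-telescope-≤ a (a + b) M) ⟩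
  + 7 / 4 *ℚ inv (a * (a + b)) ∎
  where open ℚ.≤-Reasoning

lemma2p8 : (N : ℕ) → 1 ≤ N → ∃[ B ] (B <ℚ (+ 2 / 1)) × ((M : ℕ) → partialSum N M ≤ℚ B)
lemma2p8 (suc N) _ = + 7 / 4 , *<* (ℤ.+<+ (ℕ.n<1+n 7)) , λ M → boxSum-≤ N 1 0 M
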